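{- Let $n$ be divisible by $3$. The ordered equitable partitions $(C_0,C_1,C_2,C_3)$ of $Q_n$ with quotient matrix $S^{(4)}_n$ are in one-to-one correspondence with the equitable partitions $(C,\overline C)$ of $Q_{n+3}$ with quotient matrix $S^{(2)}_{n+3}$ such that $C=C+(0\ldots0111)$ (i.e. $C$ is invariant under translation by the word of length $n+3$ whose last three coordinates are $1$ and the others $0$).
   Context: $Q_m$ is the graph on $\{0,1\}^m$ (viewed as $\mathbb F_2^m$) with two words adjacent iff they differ in exactly one position. A partition $(C_i)_{i\in I}$ of the vertices of a graph is equitable with quotient matrix $(S_{i,j})$ if every vertex of $C_i$ has exactly $S_{i,j}$ neighbours in $C_j$. For $m$ divisible by $3$ and $s=m/3$: $S^{(4)}_m$ is the $4\times4$ matrix with $0$ on the diagonal and $s$ in every off-diagonal entry, and $S^{(2)}_m=\begin{pmatrix}0&3s\\ s&2s\end{pmatrix}$. $\overline C$ denotes the complement of $C$. -}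

module Defs where

open import Data.Bool using (Bool; true; false; _xor_)
open import Data.Nat using (ℕ; zero; suc; _+_; _*_)
open import Data.Nat.DivMod using (_/_)
open import Data.Fin using (Fin) renaming (zero to fzero; suc to fsuc)
import Data.Fin as Fin
open import Data.Vec using (Vec; []; _∷_; replicate; zipWith; _++_)
open import Data.List using (List; []; _∷_; map; length; filter) renaming (_++_ to _++ₗ_)
open import Data.Product using (Σ; _×_; _,_; proj₁)
open import Relation.Binary.PropositionalEquality using (_≡_; refl; sym; trans)
open import Relation.Binary.Bundles using (Setoid)
open import Relation.Nullary using (Dec; yes; no; ¬_)
open import Relation.Nullary.Decidable using (_×-dec_)
import Data.Bool.Properties as BoolP
import Data.Nat.Properties as NatP
open import Level using (0ℓ)

-- Vertices of Q_m : binary words of length m (elements of F_2^m).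
Word : ℕ → Set
Word m = Vec Bool m

allWords : (m : ℕ) → List (Word m)
allWords zero = [] ∷ []
allWords (suc m) = map (false ∷_) (allWords m) ++ₗ map (true ∷_) (allWords m)

dist : {m : ℕ} → Word m → Word m → ℕ
dist [] [] = 0
dist (a ∷ x) (b ∷ y) with a BoolP.≟ b
... | yes _ = dist x y
... | no  _ = suc (dist x y)

Adjacent : {m : ℕ} → Word m → Word m → Set
Adjacent x y = dist x y ≡ 1

_⊕_ : {m : ℕ} → Word m → Word m → Word m
_⊕_ = zipWith _xor_

-- An ordered partition of the vertices of Q_m into k (indexed) cells,
-- given by the cell-assignment map: C_i = f⁻¹(i).
Partition : ℕ → ℕ → Set
Partition m k = Word m → Fin k

nbrsIn : {m k : ℕ} → Partition m k → Word m → Fin k → ℕ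
nbrsIn {m} f x j =
  length (filter (λ y → NatP._≟_ (dist x y) 1 ×-dec Fin._≟_ (f y) j) (allWords m))

IsEquitable : {m k : ℕ} → Partition m k → (Fin k → Fin k → ℕ) → Set
IsEquitable f S = ∀ x i j → f x ≡ i → nbrsIn f x j ≡ S i j

S4 : ℕ → Fin 4 → Fin 4 → ℕ
S4 m i j with i Fin.≟ j
... | yes _ = 0
... | no  _ = m / 3

-- S2_m = ((0, 3s), (s, 2s)); cell 0 is C, cell 1 is the complement of C.
S2 : ℕ → Fin 2 → Fin 2 → ℕ
S2 m fzero fzero = 0
S2 m fzero (fsuc fzero) = 3 * (m / 3)
S2 m (fsuc fzero) fzero = m / 3
S2 m (fsuc fzero) (fsuc fzero) = 2 * (m / 3)

e111 : (n : ℕ) → Word (n + 3)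
e111 n = replicate n false ++ (true ∷ true ∷ true ∷ [])

EP4 : ℕ → Set
EP4 n = Σ (Partition n 4) (λ f → IsEquitable f (S4 n))

-- Equitable partitions (C, C̄) of Q_{n+3} with quotient S2_{n+3}, C = C + e111
-- (C = g⁻¹(0); invariance: x ∈ C ⇔ x + e ∈ C, i.e. g (x ⊕ e) ≡ g x).
EP2inv : ℕ → Set
EP2inv n = Σ (Partition (n + 3) 2)
  (λ g → IsEquitable g (S2 (n + 3)) × (∀ x → g (x ⊕ e111 n) ≡ g x))

-- Two partitions are the same iff they have the same cells (pointwise equality
-- of the cell-assignment maps); proofs of the properties are irrelevant.
EP4-setoid : ℕ → Setoid 0ℓ 0ℓ
EP4-setoid n = record
  { Carrier = EP4 n
  ; _≈_ = λ p q → ∀ x → proj₁ p x ≡ proj₁ q x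
  ; isEquivalence = record
    { refl = λ x → refl ; sym = λ e x → sym (e x) ; trans = λ e f x → trans (e x) (f x) } }

EP2inv-setoid : ℕ → Setoid 0ℓ 0ℓ
EP2inv-setoid n = record
  { Carrier = EP2inv n
  ; _≈_ = λ p q → ∀ x → proj₁ p x ≡ proj₁ q x
  ; isEquivalence = record
    { refl = λ x → refl ; sym = λ e x → sym (e x) ; trans = λ e f x → trans (e x) (f x) } }

{-# OPTIONS --safe #-}
module Submission where

open import Defs
open import Data.Nat using (ℕ; _+_)
open import Data.Nat.Divisibility using (_∣_)
open import Function.Bundles using (Inverse)

open import Data.Bool using (Bool; true; false; not; if_then_else_)
import Data.Bool.Properties as Bool
open import Data.Empty using (⊥; ⊥-elim)
open import Data.Fin using (Fin; #_) renaming (zero to fzero; suc to fsuc)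
open import Data.Fin.Properties using (all?; any?) renaming (_≟_ to _≟ᶠ_)
open import Data.List using (List; []; _∷_; map; filter; length; allFin)
  renaming (_++_ to _++ₗ_)
open import Data.List.Properties using (map-cong; map-++; map-∘)
open import Data.Nat using (zero; suc; _*_; _≤_; _<_; z≤n; s≤s; _≟_)
open import Data.Nat.DivMod using (_/_; m*[n/m]≡n; +-distrib-/-∣ˡ)
open import Data.Nat.Divisibility using (∣-refl; ∣m∣n⇒∣m+n)
open import Data.Nat.ListAction using (sum)
open import Data.Nat.ListAction.Properties using (sum-++)
open import Data.Nat.Properties
  using ( +-comm; +-assoc; +-identityʳ; +-cancelʳ-≡; +-cancelˡ-≡; +-mono-≤; m+n≡0⇒n≡0
        ; *-zeroʳ; *-distribˡ-+; *-monoʳ-≤; n≤0⇒n≡0; ≤-trans; ≤-reflexive; m≤m+n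
        ; <-irrefl; +-commutativeSemigroup; module ≤-Reasoning )
open import Data.Nat.Tactic.RingSolver using (solve-∀)
open import Algebra.Properties.CommutativeSemigroup +-commutativeSemigroup
  using (interchange; xy∙z≈xz∙y)
open import Data.Product using (Σ; _×_; _,_; proj₁; proj₂)
open import Data.Sum using (_⊎_; inj₁; inj₂)
open import Data.Vec using (_∷_; _++_; take; drop; lookup) renaming ([] to ⟨⟩)
open import Data.Vec.Properties using (take++drop≡id; ++-injective; ≡-dec)
open import Relation.Binary.PropositionalEquality
  using (_≡_; _≢_; _≗_; refl; sym; trans; cong; cong₂; subst; module ≡-Reasoning)
open import Relation.Nullary using (Dec; yes; no; does)
open import Relation.Nullary.Decidable using (map′; _×-dec_; _⊎-dec_; from-yes)

-- Write a vertex of Q_(n+3) as y ++ z with z ∈ Q₃. Modulo ⟨111⟩ the cube Q₃ has four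
-- classes, and the closed neighbourhood of every z meets each class exactly once (Q₃ is a
-- double cover of K₄). A 4-partition f of Q_n therefore lifts to the invariant set
-- C = {y ++ z : z lies in class f y}: a vertex of C has no C-neighbours, and a vertex
-- y ++ z outside C has one C-neighbour y ++ z′ in the cube and as many C-neighbours
-- y′ ++ z as y has neighbours in cell (class of z), so C is equitable with S₂ iff f is
-- equitable with S₄. Conversely every invariant equitable C is such a lift: within
-- {y} × Q₃ it is a union of classes; it contains at most one, since C is independent
-- and distinct classes are adjacent, and at least one, since otherwise the four vertices
-- y ++ representative l would need 4(n/3 + 1) C-neighbours y′ ++ representative l, while
-- the n neighbours y′ of y carry at most one C-class each.

⟦_⟧ : {P : Set} → Dec P → ℕ
⟦ d ⟧ = if does d then 1 else 0

⟦×-dec⟧ : {P Q : Set} (p? : Dec P) (q? : Dec Q) → ⟦ p? ×-dec q? ⟧ ≡ ⟦ p? ⟧ * ⟦ q? ⟧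
⟦×-dec⟧ (yes _) (yes _) = refl
⟦×-dec⟧ (yes _) (no _)  = refl
⟦×-dec⟧ (no _)  _       = refl

⟦⟧≡1⇒ : {P : Set} (p? : Dec P) → ⟦ p? ⟧ ≡ 1 → P
⟦⟧≡1⇒ (yes p) _ = p
⟦⟧≡1⇒ (no _)  ()

sumOver : {A : Set} → List A → (A → ℕ) → ℕ
sumOver xs f = sum (map f xs)

module _ {A : Set} where

  length-filter≡sumOver : {P : A → Set} (P? : ∀ x → Dec (P x)) (xs : List A) →
                          length (filter P? xs) ≡ sumOver xs (λ x → ⟦ P? x ⟧)
  length-filter≡sumOver P? []       = refl
  length-filter≡sumOver P? (x ∷ xs) with does (P? x)
  ... | true  = cong suc (length-filter≡sumOver P? xs)
  ... | false = length-filter≡sumOver P? xs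

  sumOver-cong : (xs : List A) {f g : A → ℕ} → f ≗ g → sumOver xs f ≡ sumOver xs g
  sumOver-cong xs f≗g = cong sum (map-cong f≗g xs)

  sumOver-zero : (xs : List A) → sumOver xs (λ _ → 0) ≡ 0
  sumOver-zero []       = refl
  sumOver-zero (_ ∷ xs) = sumOver-zero xs

  sumOver-+ : (xs : List A) (f g : A → ℕ) →
              sumOver xs (λ x → f x + g x) ≡ sumOver xs f + sumOver xs g
  sumOver-+ []       f g = refl
  sumOver-+ (x ∷ xs) f g =
    trans (cong (f x + g x +_) (sumOver-+ xs f g)) (interchange (f x) (g x) _ _)

  sumOver-mono : (xs : List A) {f g : A → ℕ} → (∀ x → f x ≤ g x) →
                 sumOver xs f ≤ sumOver xs g
  sumOver-mono []       f≤g = z≤n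
  sumOver-mono (x ∷ xs) f≤g = +-mono-≤ (f≤g x) (sumOver-mono xs f≤g)

sumOver-allWords-suc : (m : ℕ) (h : Word (suc m) → ℕ) →
  sumOver (allWords (suc m)) h ≡
  sumOver (allWords m) (λ x → h (false ∷ x)) + sumOver (allWords m) (λ x → h (true ∷ x))
sumOver-allWords-suc m h = begin
  sum (map h (map (false ∷_) ws ++ₗ map (true ∷_) ws))
    ≡⟨ cong sum (map-++ h (map (false ∷_) ws) _) ⟩
  sum (map h (map (false ∷_) ws) ++ₗ map h (map (true ∷_) ws))
    ≡⟨ sum-++ (map h (map (false ∷_) ws)) _ ⟩
  sum (map h (map (false ∷_) ws)) + sum (map h (map (true ∷_) ws))
    ≡⟨ cong₂ _+_ (cong sum (sym (map-∘ ws))) (cong sum (sym (map-∘ ws))) ⟩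
  sumOver ws (λ x → h (false ∷ x)) + sumOver ws (λ x → h (true ∷ x)) ∎
  where
  open ≡-Reasoning
  ws = allWords m

sumOver-δ : {m : ℕ} (x : Word m) (h : Word m → ℕ) →
            sumOver (allWords m) (λ x′ → ⟦ dist x x′ ≟ 0 ⟧ * h x′) ≡ h x
sumOver-δ ⟨⟩ h = trans (+-identityʳ _) (+-identityʳ (h ⟨⟩))
sumOver-δ {suc m} (false ∷ x) h = begin
  sumOver (allWords (suc m)) (λ x′ → ⟦ dist (false ∷ x) x′ ≟ 0 ⟧ * h x′)
    ≡⟨ sumOver-allWords-suc m _ ⟩
  sumOver (allWords m) (λ x′ → ⟦ dist x x′ ≟ 0 ⟧ * h (false ∷ x′))
    + sumOver (allWords m) (λ _ → 0)
    ≡⟨ cong₂ _+_ (sumOver-δ x (λ x′ → h (false ∷ x′))) (sumOver-zero (allWords m)) ⟩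
  h (false ∷ x) + 0
    ≡⟨ +-identityʳ _ ⟩
  h (false ∷ x) ∎
  where open ≡-Reasoning
sumOver-δ {suc m} (true ∷ x) h =
  trans (sumOver-allWords-suc m _)
        (cong₂ _+_ (sumOver-zero (allWords m)) (sumOver-δ x (λ x′ → h (true ∷ x′))))

nbrSum : {m : ℕ} → (Word m → ℕ) → Word m → ℕ
nbrSum {m} h x = sumOver (allWords m) (λ x′ → ⟦ dist x x′ ≟ 1 ⟧ * h x′)

module _ {m : ℕ} where

  nbrsIn≡nbrSum : {k : ℕ} (f : Partition m k) (x : Word m) (j : Fin k) →
                  nbrsIn f x j ≡ nbrSum (λ x′ → ⟦ f x′ ≟ᶠ j ⟧) x
  nbrsIn≡nbrSum f x j =
    trans (length-filter≡sumOver _ (allWords m))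
          (sumOver-cong (allWords m) (λ x′ → ⟦×-dec⟧ (dist x x′ ≟ 1) (f x′ ≟ᶠ j)))

  nbrSum-cong : {h h′ : Word m → ℕ} → h ≗ h′ → (x : Word m) → nbrSum h x ≡ nbrSum h′ x
  nbrSum-cong h≗h′ x =
    sumOver-cong (allWords m) (λ x′ → cong (⟦ dist x x′ ≟ 1 ⟧ *_) (h≗h′ x′))

  nbrSum-zero : (x : Word m) → nbrSum (λ _ → 0) x ≡ 0
  nbrSum-zero x = trans (sumOver-cong (allWords m) (λ x′ → *-zeroʳ ⟦ dist x x′ ≟ 1 ⟧))
                        (sumOver-zero (allWords m))

  nbrSum-+ : (h h′ : Word m → ℕ) (x : Word m) →
             nbrSum (λ x′ → h x′ + h′ x′) x ≡ nbrSum h x + nbrSum h′ x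
  nbrSum-+ h h′ x =
    trans (sumOver-cong (allWords m) (λ x′ → *-distribˡ-+ ⟦ dist x x′ ≟ 1 ⟧ (h x′) (h′ x′)))
          (sumOver-+ (allWords m) _ _)

  nbrSum-mono : {h h′ : Word m → ℕ} → (∀ x → h x ≤ h′ x) → (x : Word m) →
                nbrSum h x ≤ nbrSum h′ x
  nbrSum-mono h≤h′ x =
    sumOver-mono (allWords m) (λ x′ → *-monoʳ-≤ ⟦ dist x x′ ≟ 1 ⟧ (h≤h′ x′))

  nbrSum-sumOver : {A : Set} (ls : List A) (ψ : A → Word m → ℕ) (x : Word m) →
                   nbrSum (λ x′ → sumOver ls (λ l → ψ l x′)) x ≡
                   sumOver ls (λ l → nbrSum (ψ l) x)
  nbrSum-sumOver []       ψ x = nbrSum-zero x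
  nbrSum-sumOver (l ∷ ls) ψ x =
    trans (nbrSum-+ (ψ l) _ x) (cong (nbrSum (ψ l) x +_) (nbrSum-sumOver ls ψ x))

nbrSum-∷ : {m : ℕ} (a : Bool) (x : Word m) (h : Word (suc m) → ℕ) →
           nbrSum h (a ∷ x) ≡ nbrSum (λ x′ → h (a ∷ x′)) x + h (not a ∷ x)
nbrSum-∷ {m} false x h =
  trans (sumOver-allWords-suc m _)
        (cong (nbrSum (λ x′ → h (false ∷ x′)) x +_) (sumOver-δ x _))
nbrSum-∷ {m} true x h =
  trans (sumOver-allWords-suc m _)
        (trans (cong (_+ nbrSum (λ x′ → h (true ∷ x′)) x) (sumOver-δ x _))
               (+-comm (h (false ∷ x)) _))

nbrSum-one : {m : ℕ} (x : Word m) → nbrSum (λ _ → 1) x ≡ m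
nbrSum-one ⟨⟩ = refl
nbrSum-one {suc m} (a ∷ x) =
  trans (nbrSum-∷ a x _) (trans (cong (_+ 1) (nbrSum-one x)) (+-comm m 1))

nbrSum-++ : {n k : ℕ} (h : Word (n + k) → ℕ) (y : Word n) (z : Word k) →
            nbrSum h (y ++ z) ≡
            nbrSum (λ y′ → h (y′ ++ z)) y + nbrSum (λ z′ → h (y ++ z′)) z
nbrSum-++ h ⟨⟩      z = refl
nbrSum-++ h (a ∷ y) z = begin
  nbrSum h (a ∷ (y ++ z))
    ≡⟨ nbrSum-∷ a (y ++ z) h ⟩
  nbrSum (λ x → h (a ∷ x)) (y ++ z) + h (not a ∷ y ++ z)
    ≡⟨ cong (_+ h (not a ∷ y ++ z)) (nbrSum-++ (λ x → h (a ∷ x)) y z) ⟩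
  along-y + along-z + h (not a ∷ y ++ z)
    ≡⟨ xy∙z≈xz∙y along-y along-z _ ⟩
  along-y + h (not a ∷ y ++ z) + along-z
    ≡⟨ cong (_+ along-z) (sym (nbrSum-∷ a y (λ y′ → h (y′ ++ z)))) ⟩
  nbrSum (λ y′ → h (y′ ++ z)) (a ∷ y) + along-z ∎
  where
  open ≡-Reasoning
  along-y = nbrSum (λ y′ → h (a ∷ y′ ++ z)) y
  along-z = nbrSum (λ z′ → h (a ∷ y ++ z′)) z

pattern C  = fzero
pattern C̄ = fsuc fzero

cell : {P : Set} → Dec P → Fin 2
cell d = if does d then C else C̄

⟦cell⟧ : {P : Set} (d : Dec P) → ⟦ cell d ≟ᶠ C ⟧ ≡ ⟦ d ⟧
⟦cell⟧ (yes _) = refl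
⟦cell⟧ (no _)  = refl

cell-yes : {P : Set} (d : Dec P) → P → cell d ≡ C
cell-yes (yes _) _ = refl
cell-yes (no ¬p) p = ⊥-elim (¬p p)

cell≡C⇒ : {P : Set} (d : Dec P) → cell d ≡ C → P
cell≡C⇒ (yes p) _ = p
cell≡C⇒ (no _)  ()

≢C⇒≡C̄ : (c : Fin 2) → c ≢ C → c ≡ C̄
≢C⇒≡C̄ C  c≢C = ⊥-elim (c≢C refl)
≢C⇒≡C̄ C̄ _   = refl

point-or-empty : {k : ℕ} (c : Fin k → Fin 2) → (∀ {i j} → c i ≡ C → c j ≡ C → i ≡ j) →
                 (Σ (Fin k) λ i → ∀ j → c j ≡ cell (i ≟ᶠ j)) ⊎ (∀ j → c j ≡ C̄)
point-or-empty c unique with any? (λ i → c i ≟ᶠ C)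
... | yes (i , ci≡C) = inj₁ (i , point)
  where
  point : ∀ j → c j ≡ cell (i ≟ᶠ j)
  point j with i ≟ᶠ j
  ... | yes refl = ci≡C
  ... | no i≢j   = ≢C⇒≡C̄ (c j) (λ cj≡C → i≢j (unique ci≡C cj≡C))
... | no none = inj₂ (λ j → ≢C⇒≡C̄ (c j) (λ cj≡C → none (j , cj≡C)))

nbrsIn-C+C̄ : {m : ℕ} (g : Partition m 2) (x : Word m) → nbrsIn g x C + nbrsIn g x C̄ ≡ m
nbrsIn-C+C̄ {m} g x = begin
  nbrsIn g x C + nbrsIn g x C̄
    ≡⟨ cong₂ _+_ (nbrsIn≡nbrSum g x C) (nbrsIn≡nbrSum g x C̄) ⟩
  nbrSum (λ x′ → ⟦ g x′ ≟ᶠ C ⟧) x + nbrSum (λ x′ → ⟦ g x′ ≟ᶠ C̄ ⟧) x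
    ≡⟨ sym (nbrSum-+ _ _ x) ⟩
  nbrSum (λ x′ → ⟦ g x′ ≟ᶠ C ⟧ + ⟦ g x′ ≟ᶠ C̄ ⟧) x
    ≡⟨ nbrSum-cong (λ x′ → one-cell (g x′)) x ⟩
  nbrSum (λ _ → 1) x
    ≡⟨ nbrSum-one x ⟩
  m ∎
  where
  open ≡-Reasoning
  one-cell : (c : Fin 2) → ⟦ c ≟ᶠ C ⟧ + ⟦ c ≟ᶠ C̄ ⟧ ≡ 1
  one-cell C  = refl
  one-cell C̄ = refl

S2-row-sum : {m : ℕ} → 3 ∣ m → (i : Fin 2) → S2 m i C + S2 m i C̄ ≡ m
S2-row-sum 3∣m C  = m*[n/m]≡n 3∣m
S2-row-sum 3∣m C̄ = m*[n/m]≡n 3∣m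

equitable-intro : {m k : ℕ} {f : Partition m k} {S : Fin k → Fin k → ℕ} →
                  (∀ x j → nbrsIn f x j ≡ S (f x) j) → IsEquitable f S
equitable-intro h x _ j refl = h x j

-- For two cells the C̄-column of the quotient matrix is forced by the degree.
equitable-from-C : {m : ℕ} → 3 ∣ m → (g : Partition m 2) →
                   (∀ x → nbrsIn g x C ≡ S2 m (g x) C) → IsEquitable g (S2 m)
equitable-from-C {m} 3∣m g hC = equitable-intro column
  where
  column : ∀ x j → nbrsIn g x j ≡ S2 m (g x) j
  column x C  = hC x
  column x C̄ = +-cancelˡ-≡ (nbrsIn g x C) _ _ (begin
    nbrsIn g x C + nbrsIn g x C̄   ≡⟨ nbrsIn-C+C̄ g x ⟩
    m                             ≡⟨ sym (S2-row-sum 3∣m (g x)) ⟩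
    S2 m (g x) C + S2 m (g x) C̄   ≡⟨ cong (_+ S2 m (g x) C̄) (sym (hC x)) ⟩
    nbrsIn g x C + S2 m (g x) C̄   ∎)
    where open ≡-Reasoning

e3 : Word 3
e3 = true ∷ true ∷ true ∷ ⟨⟩

coset : Word 3 → Fin 4
coset (false ∷ false ∷ false ∷ ⟨⟩) = # 0
coset (true  ∷ true  ∷ true  ∷ ⟨⟩) = # 0
coset (true  ∷ false ∷ false ∷ ⟨⟩) = # 1
coset (false ∷ true  ∷ true  ∷ ⟨⟩) = # 1
coset (false ∷ true  ∷ false ∷ ⟨⟩) = # 2
coset (true  ∷ false ∷ true  ∷ ⟨⟩) = # 2
coset (false ∷ false ∷ true  ∷ ⟨⟩) = # 3
coset (true  ∷ true  ∷ false ∷ ⟨⟩) = # 3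

representative : Fin 4 → Word 3
representative k = lookup
  ( (false ∷ false ∷ false ∷ ⟨⟩) ∷ (true ∷ false ∷ false ∷ ⟨⟩)
  ∷ (false ∷ true ∷ false ∷ ⟨⟩) ∷ (false ∷ false ∷ true ∷ ⟨⟩) ∷ ⟨⟩) k

all-words? : {m : ℕ} {P : Word m → Set} → (∀ w → Dec (P w)) → Dec (∀ w → P w)
all-words? {zero}  P? = map′ (λ p → λ { ⟨⟩ → p }) (λ p → p ⟨⟩) (P? ⟨⟩)
all-words? {suc m} P? =
  map′ (λ { (p₀ , p₁) (false ∷ w) → p₀ w ; (p₀ , p₁) (true ∷ w) → p₁ w })
       (λ p → (λ w → p (false ∷ w)) , (λ w → p (true ∷ w)))
       (all-words? (λ w → P? (false ∷ w)) ×-dec all-words? (λ w → P? (true ∷ w)))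

coset-⊕-e3 : ∀ z → coset (z ⊕ e3) ≡ coset z
coset-⊕-e3 = from-yes (all-words? (λ z → coset (z ⊕ e3) ≟ᶠ coset z))

coset-representative : ∀ k → coset (representative k) ≡ k
coset-representative = from-yes (all? (λ k → coset (representative k) ≟ᶠ k))

representative-coset : ∀ z → z ≡ representative (coset z) ⊎ z ≡ representative (coset z) ⊕ e3
representative-coset = from-yes (all-words? (λ z →
  ≡-dec Bool._≟_ z (representative (coset z))
    ⊎-dec ≡-dec Bool._≟_ z (representative (coset z) ⊕ e3)))

closed-nbhd-meets-class-once :
  ∀ k z → ⟦ k ≟ᶠ coset z ⟧ + nbrSum (λ z′ → ⟦ k ≟ᶠ coset z′ ⟧) z ≡ 1
closed-nbhd-meets-class-once = from-yes (all? (λ k → all-words? (λ z →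
  ⟦ k ≟ᶠ coset z ⟧ + nbrSum (λ z′ → ⟦ k ≟ᶠ coset z′ ⟧) z ≟ 1)))

sumOver-allFin-⟦≟⟧ : ∀ k → sumOver (allFin 4) (λ l → ⟦ k ≟ᶠ l ⟧) ≡ 1
sumOver-allFin-⟦≟⟧ = from-yes (all? (λ k → sumOver (allFin 4) (λ l → ⟦ k ≟ᶠ l ⟧) ≟ 1))

⊕-e111 : {n : ℕ} (y : Word n) (w : Word 3) → (y ++ w) ⊕ e111 n ≡ y ++ (w ⊕ e3)
⊕-e111 ⟨⟩          w = refl
⊕-e111 (false ∷ y) w = cong (false ∷_) (⊕-e111 y w)
⊕-e111 (true ∷ y)  w = cong (true ∷_) (⊕-e111 y w)

3t<4[t+1] : ∀ t → 3 * t < sumOver (allFin 4) (λ _ → t + 1)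
3t<4[t+1] t = subst (3 * t <_) (sym (expand t)) (s≤s (m≤m+n (3 * t) (t + 3)))
  where
  expand : ∀ t → t + 1 + (t + 1 + (t + 1 + (t + 1 + 0))) ≡ suc (3 * t + (t + 3))
  expand = solve-∀

module _ (n : ℕ) where

  split-elim : {P : Word (n + 3) → Set} → (∀ y z → P (y ++ z)) → ∀ x → P x
  split-elim {P} h x = subst P (take++drop≡id n x) (h (take n x) (drop n x))

  take-drop-++ : (y : Word n) (z : Word 3) → take n (y ++ z) ≡ y × drop n (y ++ z) ≡ z
  take-drop-++ y z = ++-injective (take n (y ++ z)) y (take++drop≡id n (y ++ z))

  Lifts : Partition n 4 → Partition (n + 3) 2 → Set
  Lifts f g = ∀ y z → g (y ++ z) ≡ cell (f y ≟ᶠ coset z)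

  lift : Partition n 4 → Partition (n + 3) 2
  lift f x = cell (f (take n x) ≟ᶠ coset (drop n x))

  lift-lifts : (f : Partition n 4) → Lifts f (lift f)
  lift-lifts f y z with take-drop-++ y z
  ... | take≡y , drop≡z = cong₂ (λ y z → cell (f y ≟ᶠ coset z)) take≡y drop≡z

  lift-invariant : (f : Partition n 4) → ∀ x → lift f (x ⊕ e111 n) ≡ lift f x
  lift-invariant f = split-elim λ y z → begin
    lift f ((y ++ z) ⊕ e111 n)     ≡⟨ cong (lift f) (⊕-e111 y z) ⟩
    lift f (y ++ (z ⊕ e3))         ≡⟨ lift-lifts f y (z ⊕ e3) ⟩
    cell (f y ≟ᶠ coset (z ⊕ e3))   ≡⟨ cong (λ k → cell (f y ≟ᶠ k)) (coset-⊕-e3 z) ⟩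
    cell (f y ≟ᶠ coset z)          ≡⟨ sym (lift-lifts f y z) ⟩
    lift f (y ++ z)                ∎
    where open ≡-Reasoning

  lifts-cong : {f f′ : Partition n 4} {g g′ : Partition (n + 3) 2} →
               Lifts f g → Lifts f′ g′ → f ≗ f′ → g ≗ g′
  lifts-cong lifts lifts′ f≗f′ = split-elim λ y z →
    trans (lifts y z) (trans (cong (λ k → cell (k ≟ᶠ coset z)) (f≗f′ y)) (sym (lifts′ y z)))

  lifts-injective : {f f′ : Partition n 4} {g g′ : Partition (n + 3) 2} →
                    Lifts f g → Lifts f′ g′ → g ≗ g′ → f ≗ f′
  lifts-injective {f} {f′} {g} {g′} lifts lifts′ g≗g′ y =
    subst (f y ≡_) (coset-representative (f′ y)) (cell≡C⇒ (f y ≟ᶠ coset r) (begin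
      cell (f y ≟ᶠ coset r)   ≡⟨ sym (lifts y r) ⟩
      g (y ++ r)              ≡⟨ g≗g′ (y ++ r) ⟩
      g′ (y ++ r)             ≡⟨ lifts′ y r ⟩
      cell (f′ y ≟ᶠ coset r)
        ≡⟨ cell-yes (f′ y ≟ᶠ coset r) (sym (coset-representative (f′ y))) ⟩
      C                       ∎))
    where
    open ≡-Reasoning
    r = representative (f′ y)

  nbrsIn-++ : (g : Partition (n + 3) 2) (y : Word n) (z : Word 3) (j : Fin 2) →
              nbrsIn g (y ++ z) j ≡
              nbrSum (λ y′ → ⟦ g (y′ ++ z) ≟ᶠ j ⟧) y
                + nbrSum (λ z′ → ⟦ g (y ++ z′) ≟ᶠ j ⟧) z
  nbrsIn-++ g y z j = trans (nbrsIn≡nbrSum g (y ++ z) j) (nbrSum-++ _ y z)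

  lift-count : {f : Partition n 4} {g : Partition (n + 3) 2} → Lifts f g → ∀ y z →
               nbrsIn g (y ++ z) C + ⟦ f y ≟ᶠ coset z ⟧ ≡ nbrsIn f y (coset z) + 1
  lift-count {f} {g} lifts y z = begin
    nbrsIn g (y ++ z) C + ⟦ f y ≟ᶠ coset z ⟧
      ≡⟨ cong (_+ ⟦ f y ≟ᶠ coset z ⟧) (nbrsIn-++ g y z C) ⟩
    nbrSum (λ y′ → ⟦ g (y′ ++ z) ≟ᶠ C ⟧) y
      + nbrSum (λ z′ → ⟦ g (y ++ z′) ≟ᶠ C ⟧) z + ⟦ f y ≟ᶠ coset z ⟧
      ≡⟨ cong (_+ ⟦ f y ≟ᶠ coset z ⟧)
              (cong₂ _+_ (nbrSum-cong (λ y′ → in-C y′ z) y) (nbrSum-cong (in-C y) z)) ⟩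
    along-y + along-z + ⟦ f y ≟ᶠ coset z ⟧
      ≡⟨ +-assoc along-y along-z _ ⟩
    along-y + (along-z + ⟦ f y ≟ᶠ coset z ⟧)
      ≡⟨ cong₂ _+_ (sym (nbrsIn≡nbrSum f y (coset z)))
                   (trans (+-comm along-z _) (closed-nbhd-meets-class-once (f y) z)) ⟩
    nbrsIn f y (coset z) + 1 ∎
    where
    open ≡-Reasoning
    along-y = nbrSum (λ y′ → ⟦ f y′ ≟ᶠ coset z ⟧) y
    along-z = nbrSum (λ z′ → ⟦ f y ≟ᶠ coset z′ ⟧) z
    in-C : ∀ y z → ⟦ g (y ++ z) ≟ᶠ C ⟧ ≡ ⟦ f y ≟ᶠ coset z ⟧
    in-C y z = trans (cong (λ c → ⟦ c ≟ᶠ C ⟧) (lifts y z)) (⟦cell⟧ (f y ≟ᶠ coset z))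

module Correspondence (n : ℕ) (3∣n : 3 ∣ n) where

  S2-S4 : (k l : Fin 4) → S2 (n + 3) (cell (k ≟ᶠ l)) C + ⟦ k ≟ᶠ l ⟧ ≡ S4 n k l + 1
  S2-S4 k l with k ≟ᶠ l
  ... | yes _ = refl
  ... | no _  = trans (+-identityʳ _) (+-distrib-/-∣ˡ 3 3∣n)

  module _ {f : Partition n 4} {g : Partition (n + 3) 2} (lifts : Lifts n f g) where

    lift-equitable : IsEquitable f (S4 n) → IsEquitable g (S2 (n + 3))
    lift-equitable eqf = equitable-from-C (∣m∣n⇒∣m+n 3∣n ∣-refl) g (split-elim n C-column)
      where
      open ≡-Reasoning
      C-column : ∀ y z → nbrsIn g (y ++ z) C ≡ S2 (n + 3) (g (y ++ z)) C
      C-column y z = +-cancelʳ-≡ ⟦ f y ≟ᶠ coset z ⟧ _ _ (begin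
        nbrsIn g (y ++ z) C + ⟦ f y ≟ᶠ coset z ⟧
          ≡⟨ lift-count n lifts y z ⟩
        nbrsIn f y (coset z) + 1
          ≡⟨ cong (_+ 1) (eqf y (f y) (coset z) refl) ⟩
        S4 n (f y) (coset z) + 1
          ≡⟨ sym (S2-S4 (f y) (coset z)) ⟩
        S2 (n + 3) (cell (f y ≟ᶠ coset z)) C + ⟦ f y ≟ᶠ coset z ⟧
          ≡⟨ cong (λ c → S2 (n + 3) c C + ⟦ f y ≟ᶠ coset z ⟧) (sym (lifts y z)) ⟩
        S2 (n + 3) (g (y ++ z)) C + ⟦ f y ≟ᶠ coset z ⟧ ∎)

    unlift-equitable : IsEquitable g (S2 (n + 3)) → IsEquitable f (S4 n)
    unlift-equitable eqg = equitable-intro λ y l →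
      subst (λ l → nbrsIn f y l ≡ S4 n (f y) l) (coset-representative l) (row y (representative l))
      where
      open ≡-Reasoning
      row : ∀ y z → nbrsIn f y (coset z) ≡ S4 n (f y) (coset z)
      row y z = +-cancelʳ-≡ 1 _ _ (begin
        nbrsIn f y (coset z) + 1
          ≡⟨ sym (lift-count n lifts y z) ⟩
        nbrsIn g (y ++ z) C + ⟦ f y ≟ᶠ coset z ⟧
          ≡⟨ cong (_+ ⟦ f y ≟ᶠ coset z ⟧) (eqg (y ++ z) _ C (lifts y z)) ⟩
        S2 (n + 3) (cell (f y ≟ᶠ coset z)) C + ⟦ f y ≟ᶠ coset z ⟧
          ≡⟨ S2-S4 (f y) (coset z) ⟩
        S4 n (f y) (coset z) + 1 ∎)

  module Unlift (g : Partition (n + 3) 2) (eqg : IsEquitable g (S2 (n + 3)))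
                (inv : ∀ x → g (x ⊕ e111 n) ≡ g x) where

    column : Word n → Fin 4 → Fin 2
    column y l = g (y ++ representative l)

    g-column : ∀ y z → g (y ++ z) ≡ column y (coset z)
    g-column y z with representative-coset z
    ... | inj₁ z≡r    = cong (λ w → g (y ++ w)) z≡r
    ... | inj₂ z≡r⊕e3 = begin
      g (y ++ z)              ≡⟨ cong (λ w → g (y ++ w)) z≡r⊕e3 ⟩
      g (y ++ (r ⊕ e3))       ≡⟨ cong g (sym (⊕-e111 y r)) ⟩
      g ((y ++ r) ⊕ e111 n)   ≡⟨ inv (y ++ r) ⟩
      g (y ++ r)              ∎
      where
      open ≡-Reasoning
      r = representative (coset z)

    at-most-one-class : ∀ y {k l} → column y k ≡ C → column y l ≡ C → k ≡ l
    at-most-one-class y {k} {l} yk∈C yl∈C =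
      sym (subst (l ≡_) (coset-representative k) (⟦⟧≡1⇒ (l ≟ᶠ coset rk) l-in-closed-nbhd))
      where
      rk = representative k
      C-nbrs-in-Q₃ : nbrSum (λ z′ → ⟦ g (y ++ z′) ≟ᶠ C ⟧) rk ≡ 0
      C-nbrs-in-Q₃ = m+n≡0⇒n≡0 (nbrSum (λ y′ → ⟦ g (y′ ++ rk) ≟ᶠ C ⟧) y)
                       (trans (sym (nbrsIn-++ n g y rk C)) (eqg (y ++ rk) C C yk∈C))
      class-l-below-C : ∀ z′ → ⟦ l ≟ᶠ coset z′ ⟧ ≤ ⟦ g (y ++ z′) ≟ᶠ C ⟧
      class-l-below-C z′ with l ≟ᶠ coset z′
      ... | yes refl = ≤-reflexive (cong (λ c → ⟦ c ≟ᶠ C ⟧) (sym (trans (g-column y z′) yl∈C)))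
      ... | no _     = z≤n
      l-nbrs : nbrSum (λ z′ → ⟦ l ≟ᶠ coset z′ ⟧) rk ≡ 0
      l-nbrs = n≤0⇒n≡0 (≤-trans (nbrSum-mono class-l-below-C rk) (≤-reflexive C-nbrs-in-Q₃))
      l-in-closed-nbhd : ⟦ l ≟ᶠ coset rk ⟧ ≡ 1
      l-in-closed-nbhd = trans (sym (+-identityʳ _))
        (trans (cong (⟦ l ≟ᶠ coset rk ⟧ +_) (sym l-nbrs)) (closed-nbhd-meets-class-once l rk))

    C-classes : Word n → ℕ
    C-classes y = sumOver (allFin 4) (λ l → ⟦ column y l ≟ᶠ C ⟧)

    C-classes≤1 : ∀ y → C-classes y ≤ 1
    C-classes≤1 y with point-or-empty (column y) (at-most-one-class y)
    ... | inj₁ (k , point) = ≤-reflexive (trans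
          (sumOver-cong (allFin 4) (λ l →
             trans (cong (λ c → ⟦ c ≟ᶠ C ⟧) (point l)) (⟦cell⟧ (k ≟ᶠ l))))
          (sumOver-allFin-⟦≟⟧ k))
    ... | inj₂ empty = subst (_≤ 1)
          (sym (sumOver-cong (allFin 4) (λ l → cong (λ c → ⟦ c ≟ᶠ C ⟧) (empty l))))
          z≤n

    empty-column-impossible : ∀ y → (∀ l → column y l ≡ C̄) → ⊥
    empty-column-impossible y empty = <-irrefl refl (begin-strict
      3 * (n / 3)                               <⟨ 3t<4[t+1] (n / 3) ⟩
      sumOver (allFin 4) (λ _ → n / 3 + 1)
        ≡⟨ sumOver-cong (allFin 4) (λ l → sym (C-nbrs l)) ⟩
      sumOver (allFin 4) (λ l → along-y l)
        ≡⟨ sym (nbrSum-sumOver (allFin 4) (λ l y′ → ⟦ column y′ l ≟ᶠ C ⟧) y) ⟩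
      nbrSum C-classes y                        ≤⟨ nbrSum-mono C-classes≤1 y ⟩
      nbrSum (λ _ → 1) y                        ≡⟨ nbrSum-one y ⟩
      n                                         ≡⟨ sym (m*[n/m]≡n 3∣n) ⟩
      3 * (n / 3)                               ∎)
      where
      open ≤-Reasoning
      along-y : Fin 4 → ℕ
      along-y l = nbrSum (λ y′ → ⟦ column y′ l ≟ᶠ C ⟧) y
      no-C-in-Q₃ : ∀ l → nbrSum (λ z′ → ⟦ g (y ++ z′) ≟ᶠ C ⟧) (representative l) ≡ 0
      no-C-in-Q₃ l = trans
        (nbrSum-cong (λ z′ → cong (λ c → ⟦ c ≟ᶠ C ⟧)
                                  (trans (g-column y z′) (empty (coset z′))))
                     (representative l))
        (nbrSum-zero (representative l))
      C-nbrs : ∀ l → along-y l ≡ n / 3 + 1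
      C-nbrs l = begin-equality
        along-y l                                  ≡⟨ sym (+-identityʳ _) ⟩
        along-y l + 0                              ≡⟨ cong (along-y l +_) (sym (no-C-in-Q₃ l)) ⟩
        along-y l
          + nbrSum (λ z′ → ⟦ g (y ++ z′) ≟ᶠ C ⟧) (representative l)
                                                   ≡⟨ sym (nbrsIn-++ n g y _ C) ⟩
        nbrsIn g (y ++ representative l) C         ≡⟨ eqg _ C̄ C (empty l) ⟩
        (n + 3) / 3                                ≡⟨ +-distrib-/-∣ˡ 3 3∣n ⟩
        n / 3 + 1                                  ∎

    has-class : ∀ y → Σ (Fin 4) λ k → ∀ l → column y l ≡ cell (k ≟ᶠ l)
    has-class y with point-or-empty (column y) (at-most-one-class y)
    ... | inj₁ point = point
    ... | inj₂ empty = ⊥-elim (empty-column-impossible y empty)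

    class : Partition n 4
    class y = proj₁ (has-class y)

    lifts-class : Lifts n class g
    lifts-class y z = trans (g-column y z) (proj₂ (has-class y) (coset z))

  to : EP4 n → EP2inv n
  to (f , eqf) = lift n f , lift-equitable (lift-lifts n f) eqf , lift-invariant n f

  from : EP2inv n → EP4 n
  from (g , eqg , inv) = class , unlift-equitable lifts-class eqg
    where open Unlift g eqg inv

  to-lifts : (F : EP4 n) → Lifts n (proj₁ F) (proj₁ (to F))
  to-lifts (f , _) = lift-lifts n f

  from-lifts : (G : EP2inv n) → Lifts n (proj₁ (from G)) (proj₁ G)
  from-lifts (g , eqg , inv) = Unlift.lifts-class g eqg inv

lemma2 : (n : ℕ) → 3 ∣ n → Inverse (EP4-setoid n) (EP2inv-setoid n)
lemma2 n 3∣n = record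
  { to        = to
  ; from      = from
  ; to-cong   = λ {F} {F′} → lifts-cong n (to-lifts F) (to-lifts F′)
  ; from-cong = λ {G} {G′} → lifts-injective n (from-lifts G) (from-lifts G′)
  ; inverse   = (λ {G} {F} → lifts-cong n (to-lifts F) (from-lifts G))
              , (λ {F} {G} → lifts-injective n (from-lifts G) (to-lifts F))
  }
  where open Correspondence n 3∣n
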